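{- Let \(\vec G\) and \(\vec H\) be oriented graphs that are each complete convex. Then any oriented graph formed by identifying any arc of \(\vec G\) with any arc of \(\vec H\) (tail with tail, head with head) is complete convex.
   Context: Oriented graphs: anti-symmetric digraphs without parallel arcs. A \(2\)-dipath \(u,v,w\) with centre \(v\): \(uv,vw\) arcs, \(u\ne v\ne w\). A vertex set \(S\) is convex if no vertex outside \(S\) is the centre of a \(2\)-dipath with both ends in \(S\); \(conv(S)\) is the smallest convex superset of \(S\). An oriented graph is complete convex if \(conv(\{u,v\})\) is the whole vertex set for every arc \(uv\). -}

module Defs where

open import Data.Nat using (ℕ)
open import Data.Fin using (Fin)
open import Data.Bool using (Bool; true; false)
open import Data.Product using (Σ; ∃; _×_; _,_)
open import Data.Sum using (_⊎_)
open import Relation.Binary.PropositionalEquality using (_≡_)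
open import Function.Definitions using (Injective)

record OGraph : Set where
  field
    n       : ℕ
    adj     : Fin n → Fin n → Bool
    irrefl  : ∀ u → adj u u ≡ false
    antisym : ∀ u v → adj u v ≡ true → adj v u ≡ false

open OGraph public

V : OGraph → Set
V G = Fin (n G)

Arc : (G : OGraph) → V G → V G → Set
Arc G u v = adj G u v ≡ true

Convex : (G : OGraph) → (V G → Set) → Set
Convex G S = ∀ u v w → S u → S w → Arc G u v → Arc G v w → S v

-- x ∈ conv(S): x lies in every convex superset of S
-- (conv(S) is the intersection of all convex supersets of S).
InConv : (G : OGraph) → (V G → Set) → V G → Set₁
InConv G S x = (T : V G → Set) → Convex G T → (∀ y → S y → T y) → T x

Pair : {A : Set} → A → A → A → Set
Pair u v x = (x ≡ u) ⊎ (x ≡ v)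

CompleteConvex : OGraph → Set₁
CompleteConvex G = ∀ u v → Arc G u v → ∀ x → InConv G (Pair u v) x

record ArcIdentification (G H K : OGraph)
       (a b : V G) (c d : V H) : Set where
  field
    f      : V G → V K
    g      : V H → V K
    f-inj  : Injective _≡_ _≡_ f
    g-inj  : Injective _≡_ _≡_ g
    tails  : f a ≡ g c
    heads  : f b ≡ g d
    cover  : ∀ x → (∃ λ u → f u ≡ x) ⊎ (∃ λ w → g w ≡ x)
    meet   : ∀ u w → f u ≡ g w → ((u ≡ a) × (w ≡ c)) ⊎ ((u ≡ b) × (w ≡ d))
    arcs⇒  : ∀ x y → Arc K x y →
             (∃ λ u → ∃ λ v → Arc G u v × f u ≡ x × f v ≡ y) ⊎
             (∃ λ u → ∃ λ v → Arc H u v × g u ≡ x × g v ≡ y)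
    arcsG  : ∀ u v → Arc G u v → Arc K (f u) (f v)
    arcsH  : ∀ u v → Arc H u v → Arc K (g u) (g v)

-- A convex set T of K pulls back along an arc-preserving map from a complete
-- convex graph: if T contains the images of the ends of one arc, it contains
-- the whole image. In the identified graph the arc x → y of K lies in the
-- image of G or of H; so T contains that image, in particular the shared arc,
-- hence also the image of the other graph, and the two images cover K.
module Submission where

open import Defs
open import Data.Product using (∃; _×_; _,_; proj₁; proj₂)
open import Data.Sum using (_⊎_; inj₁; inj₂)
open import Function using (_∘_)
open import Relation.Binary.PropositionalEquality using (_≡_; refl; subst; sym)

ArcPreserving : (G K : OGraph) → (V G → V K) → Set
ArcPreserving G K f = ∀ u v → Arc G u v → Arc K (f u) (f v)

module _ {G K : OGraph} {f : V G → V K} (f-arcs : ArcPreserving G K f) where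

  convex-preimage : {T : V K → Set} → Convex K T → Convex G (T ∘ f)
  convex-preimage convT u v w tu tw uv vw =
    convT (f u) (f v) (f w) tu tw (f-arcs u v uv) (f-arcs v w vw)

  image⊆convex : CompleteConvex G → {T : V K → Set} → Convex K T →
                 ∀ {u v} → Arc G u v → T (f u) → T (f v) → ∀ z → T (f z)
  image⊆convex ccG {T} convT {u} {v} uv tu tv z =
    ccG u v uv z (T ∘ f) (convex-preimage convT) pair⊆
    where
    pair⊆ : ∀ y → Pair u v y → T (f y)
    pair⊆ y (inj₁ refl) = tu
    pair⊆ y (inj₂ refl) = tv

lemma4 : (G H K : OGraph) (a b : V G) (c d : V H) →
         CompleteConvex G → CompleteConvex H →
         Arc G a b → Arc H c d →
         ArcIdentification G H K a b c d →
         CompleteConvex K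
lemma4 G H K a b c d ccG ccH ab cd I x y xy z T convT xy⊆T =
  covered (cover z)
  where
  open ArcIdentification I

  tx : T x
  tx = xy⊆T x (inj₁ refl)
  ty : T y
  ty = xy⊆T y (inj₂ refl)

  G-image⊆T : ∀ {u v} → Arc G u v → T (f u) → T (f v) → ∀ w → T (f w)
  G-image⊆T = image⊆convex {G} {K} arcsG ccG convT

  H-image⊆T : ∀ {u v} → Arc H u v → T (g u) → T (g v) → ∀ w → T (g w)
  H-image⊆T = image⊆convex {H} {K} arcsH ccH convT

  G⊆T⇒H⊆T : (∀ w → T (f w)) → ∀ w → T (g w)
  G⊆T⇒H⊆T fT = H-image⊆T cd (subst T tails (fT a)) (subst T heads (fT b))

  H⊆T⇒G⊆T : (∀ w → T (g w)) → ∀ w → T (f w)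
  H⊆T⇒G⊆T gT = G-image⊆T ab (subst T (sym tails) (gT c)) (subst T (sym heads) (gT d))

  images⊆T : (∀ w → T (f w)) × (∀ w → T (g w))
  images⊆T with arcs⇒ x y xy
  ... | inj₁ (u , v , uv , refl , refl) = let fT = G-image⊆T uv tx ty in fT , G⊆T⇒H⊆T fT
  ... | inj₂ (u , v , uv , refl , refl) = let gT = H-image⊆T uv tx ty in H⊆T⇒G⊆T gT , gT

  covered : (∃ λ u → f u ≡ z) ⊎ (∃ λ w → g w ≡ z) → T z
  covered (inj₁ (u , refl)) = proj₁ images⊆T u
  covered (inj₂ (w , refl)) = proj₂ images⊆T w
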